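{- If $G$ is a chromatically invariant $2$-edge-coloured graph, then every induced subgraph of $G$ is chromatically invariant.
   Context: All graphs are finite and simple. A $2$-edge-coloured graph is a triple $G=(\Gamma,R,B)$ with $R,B\subseteq E(\Gamma)$, $R\cap B=\emptyset$, $R\cup B=E(\Gamma)$ (red and blue edges); induced subgraphs inherit edge colours. A $k$-colouring of $G$ is a proper vertex colouring $c:V(\Gamma)\to\{1,\dots,k\}$ of $\Gamma$ such that for every $ux\in R$ and $vy\in B$ (either endpoint may play the role of $u$, resp. $v$), $c(u)=c(v)$ implies $c(x)\ne c(y)$. $P(G,\lambda)$ is the polynomial whose value at each non-negative integer $k$ is the number of $k$-colourings of $G$. $G$ is chromatically invariant if $P(G,\lambda)=P(\Gamma,\lambda)$, the usual chromatic polynomial of $\Gamma$. -}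

module Defs where

open import Data.Nat using (ℕ; zero; suc)
open import Data.Fin using (Fin)
open import Data.Fin.Properties using (all?) renaming (_≟_ to _≟ᶠ_)
open import Data.Maybe using (Maybe; just; nothing)
open import Data.Vec using (Vec; []; _∷_; lookup)
open import Data.List using (List; []; _∷_; [_]; length; filter; concatMap; map; allFin)
open import Data.Sum using (_⊎_; inj₁; inj₂)
open import Data.Product using (_×_; _,_)
open import Data.Empty using (⊥)
open import Function.Definitions using (Injective)
open import Relation.Nullary using (Dec; yes; no; ¬_)
open import Relation.Nullary.Decidable using (_⊎-dec_; _×-dec_; _→-dec_; ¬?)
open import Relation.Binary.PropositionalEquality using (_≡_; _≢_; refl; cong)

data EColour : Set where
  red blue : EColour

-- A 2-edge-coloured (finite simple) graph on vertex set Fin n.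
-- col u x = nothing : u and x are non-adjacent;
-- col u x = just red / just blue : ux is a red / blue edge.
record ECGraph (n : ℕ) : Set where
  field
    col   : Fin n → Fin n → Maybe EColour
    sym   : ∀ u x → col u x ≡ col x u
    irrefl : ∀ u → col u u ≡ nothing
open ECGraph public

Red : ∀ {n} → ECGraph n → Fin n → Fin n → Set
Red G u x = col G u x ≡ just red

Blue : ∀ {n} → ECGraph n → Fin n → Fin n → Set
Blue G u x = col G u x ≡ just blue

Edge : ∀ {n} → ECGraph n → Fin n → Fin n → Set
Edge G u x = Red G u x ⊎ Blue G u x

IsProper : ∀ {n k} → ECGraph n → (Fin n → Fin k) → Set
IsProper G c = ∀ u x → Edge G u x → c u ≢ c x

-- k-colouring of the 2-edge-coloured graph G
-- (ordered vertex pairs, so either endpoint may play the role of u, resp. v)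
IsECColouring : ∀ {n k} → ECGraph n → (Fin n → Fin k) → Set
IsECColouring G c =
  IsProper G c × (∀ u x v y → Red G u x → Blue G v y → c u ≡ c v → c x ≢ c y)

isRed? : ∀ (m : Maybe EColour) → Dec (m ≡ just red)
isRed? nothing = no (λ ())
isRed? (just red) = yes refl
isRed? (just blue) = no (λ ())

isBlue? : ∀ (m : Maybe EColour) → Dec (m ≡ just blue)
isBlue? nothing = no (λ ())
isBlue? (just red) = no (λ ())
isBlue? (just blue) = yes refl

isProper? : ∀ {n k} (G : ECGraph n) (c : Fin n → Fin k) → Dec (IsProper G c)
isProper? G c = all? λ u → all? λ x →
  (isRed? (col G u x) ⊎-dec isBlue? (col G u x)) →-dec ¬? (c u ≟ᶠ c x)

isECColouring? : ∀ {n k} (G : ECGraph n) (c : Fin n → Fin k) → Dec (IsECColouring G c)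
isECColouring? G c = isProper? G c ×-dec
  (all? λ u → all? λ x → all? λ v → all? λ y →
     isRed? (col G u x) →-dec (isBlue? (col G v y) →-dec
       ((c u ≟ᶠ c v) →-dec ¬? (c x ≟ᶠ c y))))

allVecs : (n k : ℕ) → List (Vec (Fin k) n)
allVecs zero k = [ [] ]
allVecs (suc n) k = concatMap (λ v → map (λ i → i ∷ v) (allFin k)) (allVecs n k)

chromΓ : ∀ {n} → ECGraph n → ℕ → ℕ
chromΓ {n} G k = length (filter (λ v → isProper? G (lookup v)) (allVecs n k))

chromG : ∀ {n} → ECGraph n → ℕ → ℕ
chromG {n} G k = length (filter (λ v → isECColouring? G (lookup v)) (allVecs n k))

-- P(G,λ) = P(Γ,λ) as polynomials, i.e. they agree at every non-negative integer
ChromInvariant : ∀ {n} → ECGraph n → Set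
ChromInvariant G = ∀ k → chromG G k ≡ chromΓ G k

induced : ∀ {m n} → ECGraph n → (Fin m → Fin n) → ECGraph m
induced G ι = record
  { col = λ u x → col G (ι u) (ι x)
  ; sym = λ u x → sym G (ι u) (ι x)
  ; irrefl = λ u → irrefl G (ι u)
  }

module Submission where

-- For a fixed number of colours k, P(G,k) counts a subset of the
-- proper k-colourings of Γ, so  P(G,k) = P(Γ,k)  holds exactly when every
-- proper k-colouring of Γ is already a k-colouring of G.
--
-- Let H = G[ι] be an induced subgraph on m of the n vertices, and c a proper
-- k-colouring of its underlying graph.  Extend c to all of Γ with k + n
-- colours by giving every vertex outside the image of ι its own fresh colour.
-- The extension is proper, so by chromatic invariance of G (at k + n colours)
-- it is a colouring of G; restricting it back along ι shows that c is a
-- colouring of H.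

open import Defs
open import Data.Nat using (ℕ; _+_)
open import Data.Nat.Properties using (≤-antisym)
open import Data.Fin using (Fin; _↑ˡ_; _↑ʳ_; splitAt)
open import Data.Fin.Properties using (any?; ↑ˡ-injective; ↑ʳ-injective; splitAt-↑ˡ; splitAt-↑ʳ)
  renaming (_≟_ to _≟ᶠ_)
open import Data.Vec using (Vec; []; _∷_; lookup; tabulate)
open import Data.Vec.Properties using (lookup∘tabulate)
open import Data.List using (length; filter; map; allFin)
open import Data.List.Membership.Propositional using (_∈_)
open import Data.List.Membership.Propositional.Properties
  using (∈-filter⁺; ∈-filter⁻; ∈-concatMap⁺; ∈-map⁺; ∈-allFin)
open import Data.List.Relation.Unary.Any using (here)
import Data.List.Relation.Unary.Any as Any
open import Data.List.Relation.Binary.Sublist.Propositional using (⊆-refl) renaming (_⊆_ to _⊑_)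
open import Data.List.Relation.Binary.Sublist.Propositional.Properties using (filter⁺; length-mono-≤)
open import Data.List.Relation.Binary.Sublist.Heterogeneous.Properties using (toPointwise)
open import Data.List.Relation.Binary.Pointwise using (Pointwise-≡⇒≡)
open import Data.Product using (∃; _×_; _,_; proj₁; proj₂)
open import Data.Sum using (_⊎_; inj₁; inj₂)
open import Function.Definitions using (Injective)
open import Level using (Level)
open import Relation.Nullary using (yes; no; ¬_; contradiction)
open import Relation.Unary using (Pred; Decidable; _⊆_)
open import Relation.Binary.PropositionalEquality
  using (_≡_; _≢_; _≗_; refl; trans; cong; subst) renaming (sym to ≡-sym)

private variable
  a p q : Level
  A : Set a

filter-mono : {P : Pred A p} {Q : Pred A q} (P? : Decidable P) (Q? : Decidable Q) →
              P ⊆ Q → ∀ xs → filter P? xs ⊑ filter Q? xs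
filter-mono P? Q? P⊆Q xs = filter⁺ P? Q? (λ { refl → P⊆Q }) (⊆-refl {x = xs})

-- Counting with a stronger predicate P ⊆ Q: the counts agree iff P and Q agree
-- on the list.  This turns P(G,k) = P(Γ,k) into a statement about colourings.
module _ {P : Pred A p} {Q : Pred A q} (P? : Decidable P) (Q? : Decidable Q) (P⊆Q : P ⊆ Q) where

  length-filter-≡ : Q ⊆ P → ∀ xs → length (filter P? xs) ≡ length (filter Q? xs)
  length-filter-≡ Q⊆P xs =
    ≤-antisym (length-mono-≤ (filter-mono P? Q? P⊆Q xs)) (length-mono-≤ (filter-mono Q? P? Q⊆P xs))

  -- Equal counts force the two filtered lists to coincide, since one is a
  -- sublist of the other; so every Q-element of the list is a P-element.
  length-filter-≡⇒ : ∀ xs → length (filter P? xs) ≡ length (filter Q? xs) →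
                     ∀ {x} → x ∈ xs → Q x → P x
  length-filter-≡⇒ xs eq x∈xs qx =
    proj₂ (∈-filter⁻ P? {xs = xs} (subst (_ ∈_) filters-equal (∈-filter⁺ Q? x∈xs qx)))
    where
    filters-equal : filter Q? xs ≡ filter P? xs
    filters-equal = ≡-sym (Pointwise-≡⇒≡ (toPointwise eq (filter-mono P? Q? P⊆Q xs)))

allVecs-complete : ∀ {n k} (v : Vec (Fin k) n) → v ∈ allVecs n k
allVecs-complete []      = here refl
allVecs-complete {k = k} (i ∷ v) =
  ∈-concatMap⁺ (λ w → map (_∷ w) (allFin k))
    (Any.map (λ { refl → ∈-map⁺ (_∷ v) (∈-allFin i) }) (allVecs-complete v))

module _ {n k} (G : ECGraph n) {c d : Fin n → Fin k} (c≗d : c ≗ d) where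

  proper-resp : IsProper G c → IsProper G d
  proper-resp proper u x e du≡dx =
    proper u x e (trans (c≗d u) (trans du≡dx (≡-sym (c≗d x))))

  colouring-resp : IsECColouring G c → IsECColouring G d
  colouring-resp (proper , compatible) =
    proper-resp proper ,
    λ u x v y r b du≡dv dx≡dy →
      compatible u x v y r b (trans (c≗d u) (trans du≡dv (≡-sym (c≗d v))))
                             (trans (c≗d x) (trans dx≡dy (≡-sym (c≗d y))))

module _ {n} (G : ECGraph n) (k : ℕ) where

  private
    proper? : Decidable (λ (v : Vec (Fin k) n) → IsProper G (lookup v))
    proper? v = isProper? G (lookup v)

    colouring? : Decidable (λ (v : Vec (Fin k) n) → IsECColouring G (lookup v))
    colouring? v = isECColouring? G (lookup v)

  proper-colourings-suffice : (∀ c → IsProper G c → IsECColouring G c) →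
                              chromG G k ≡ chromΓ G k
  proper-colourings-suffice all-proper-colour =
    length-filter-≡ colouring? proper? proj₁ (λ {v} → all-proper-colour (lookup v)) (allVecs n k)

  invariant⇒proper-colourings : chromG G k ≡ chromΓ G k →
                                ∀ c → IsProper G c → IsECColouring G c
  invariant⇒proper-colourings invariant c proper =
    colouring-resp G (lookup∘tabulate c)
      (length-filter-≡⇒ colouring? proper? proj₁ (allVecs n k) invariant
        (allVecs-complete (tabulate c))
        (proper-resp G (λ i → ≡-sym (lookup∘tabulate c i)) proper))

edge-irrefl : ∀ {n} (G : ECGraph n) {v} → ¬ Edge G v v
edge-irrefl G {v} (inj₁ red-loop)  with trans (≡-sym (irrefl G v)) red-loop
... | ()
edge-irrefl G {v} (inj₂ blue-loop) with trans (≡-sym (irrefl G v)) blue-loop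
... | ()

↑ˡ≢↑ʳ : ∀ {k n} (i : Fin k) (j : Fin n) → i ↑ˡ n ≢ k ↑ʳ j
↑ˡ≢↑ʳ {k} {n} i j same with trans (≡-sym (splitAt-↑ˡ k i n)) (trans (cong (splitAt k) same) (splitAt-↑ʳ k n j))
... | ()

module Extension {m n k} (ι : Fin m → Fin n) (c : Fin m → Fin k) where

  extend : Fin n → Fin (k + n)
  extend v with any? (λ u → ι u ≟ᶠ v)
  ... | yes (u , _) = c u ↑ˡ n
  ... | no _        = k ↑ʳ v

  extend-cases : ∀ v → (∃ λ u → ι u ≡ v × extend v ≡ c u ↑ˡ n)
                     ⊎ ((∀ u → ι u ≢ v) × extend v ≡ k ↑ʳ v)
  extend-cases v with any? (λ u → ι u ≟ᶠ v)
  ... | yes (u , ιu≡v) = inj₁ (u , ιu≡v , refl)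
  ... | no no-preimage = inj₂ ((λ u ιu≡v → no-preimage (u , ιu≡v)) , refl)

  extend-ι : Injective _≡_ _≡_ ι → ∀ u → extend (ι u) ≡ c u ↑ˡ n
  extend-ι inj u with extend-cases (ι u)
  ... | inj₁ (u′ , ιu′≡ιu , eq) = trans eq (cong (λ w → c w ↑ˡ n) (inj ιu′≡ιu))
  ... | inj₂ (fresh , _)        = contradiction refl (fresh u)

  extend-proper : (G : ECGraph n) → IsProper (induced G ι) c → IsProper G extend
  extend-proper G proper v w e same with extend-cases v | extend-cases w
  ... | inj₁ (u , refl , ev) | inj₁ (u′ , refl , ew) =
    proper u u′ e (↑ˡ-injective n (c u) (c u′) (trans (≡-sym ev) (trans same ew)))
  ... | inj₁ (u , _ , ev)    | inj₂ (_ , ew)         = ↑ˡ≢↑ʳ (c u) w (trans (≡-sym ev) (trans same ew))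
  ... | inj₂ (_ , ev)        | inj₁ (u′ , _ , ew)    = ↑ˡ≢↑ʳ (c u′) v (trans (≡-sym ew) (trans (≡-sym same) ev))
  ... | inj₂ (_ , ev)        | inj₂ (_ , ew)         =
    edge-irrefl G (subst (Edge G v) (≡-sym (↑ʳ-injective k v w (trans (≡-sym ev) (trans same ew)))) e)

open Extension using (extend; extend-ι; extend-proper)

colouring-restricts : ∀ {m n k k′} (G : ECGraph n) (ι : Fin m → Fin n)
                      {d : Fin n → Fin k′} (f : Fin k → Fin k′) (c : Fin m → Fin k) →
                      (∀ u → d (ι u) ≡ f (c u)) →
                      IsECColouring G d → IsECColouring (induced G ι) c
colouring-restricts G ι {d} f c d∘ι≡f∘c (proper , compatible) =
  (λ u x e cu≡cx → proper (ι u) (ι x) e (lift cu≡cx)) ,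
  (λ u x v y r b cu≡cv cx≡cy → compatible (ι u) (ι x) (ι v) (ι y) r b (lift cu≡cv) (lift cx≡cy))
  where
  lift : ∀ {u v} → c u ≡ c v → d (ι u) ≡ d (ι v)
  lift {u} {v} cu≡cv = trans (d∘ι≡f∘c u) (trans (cong f cu≡cv) (≡-sym (d∘ι≡f∘c v)))

corollary9 : ∀ {n} (G : ECGraph n) → ChromInvariant G →
    ∀ {m} (ι : Fin m → Fin n) → Injective _≡_ _≡_ ι → ChromInvariant (induced G ι)
corollary9 {n} G invariant ι inj k =
  proper-colourings-suffice (induced G ι) k λ c proper →
    colouring-restricts G ι (_↑ˡ n) c (extend-ι ι c inj)
      (invariant⇒proper-colourings G (k + n) (invariant (k + n))
        (extend ι c) (extend-proper ι c G proper))
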